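{- Let $w \in V^*$ with $|w| = n$ and let $a \in V$. If $w a^n \in Q_{\overline{I}}$, then $w b^n \in Q_I$ for every $b \in V$ with $b \ne a$.
   Context: $V$ is a finite alphabet with at least two distinct letters; $V^*$ is the set of all finite words over $V$ (including the empty word), $|w|$ is the length of $w$. A nonempty word $w$ is primitive if it is not of the form $v^n$ for a word $v$ and an integer $n \ge 2$; $Q$ is the set of primitive words. For a word $w$ of length $n$, $w[1..i]$ denotes its prefix of length $i$ and $w[i+1..n]$ its suffix of length $n-i$. A primitive word $w$ of length $n$ is ins-robust if for every $i \in \{0,\ldots,n\}$ and every $c \in V$ the word $w[1..i]\,c\,w[i+1..n]$ is primitive; $Q_I$ is the set of ins-robust primitive words and $Q_{\overline{I}} = Q \setminus Q_I$. -}

module Defs where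

open import Data.Nat using (ℕ; zero; suc; _≥_; _≤_)
open import Data.Fin using (Fin)
open import Data.List using (List; []; _∷_; _++_; length; take; drop; replicate; concat)
open import Data.Product using (Σ; _×_; _,_)
open import Relation.Binary.PropositionalEquality using (_≡_; _≢_)
open import Relation.Nullary using (¬_)

-- The alphabet V is Fin k (a finite alphabet); |V| ≥ 2 is a hypothesis of the theorem.
-- Words over V.
Word : ℕ → Set
Word k = List (Fin k)

_^^_ : {k : ℕ} → Word k → ℕ → Word k
v ^^ zero = []
v ^^ suc n = v ++ (v ^^ n)

Primitive : {k : ℕ} → Word k → Set
Primitive {k} w = (w ≢ []) × ¬ (Σ (Word k) λ v → Σ ℕ λ n → (n ≥ 2) × (w ≡ v ^^ n))

insertAt : {k : ℕ} → ℕ → Fin k → Word k → Word k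
insertAt i c w = take i w ++ (c ∷ drop i w)

-- ins-robust primitive word (member of Q_I)
InsRobust : {k : ℕ} → Word k → Set
InsRobust {k} w = Primitive w × ((i : ℕ) → i ≤ length w → (c : Fin k) → Primitive (insertAt i c w))

-- member of Q_{\overline I} = Q \ Q_I
NonInsRobust : {k : ℕ} → Word k → Set
NonInsRobust w = Primitive w × ¬ InsRobust w

-- Let an insertion of c into x = w eⁿ, |w| = n, be a proper power vᵖ; it has length 2n + 1, so |v| ≤ n.
-- If c goes into w, or c = e, the power ends in a constant block of length ≥ |v|, so v and then w lie
-- in e*.  Otherwise c is an isolated letter inside the block eⁿ: a period |v| shorter than the distance
-- from c to either end of the block would copy c into the block, so n < 2|v|, which forces p = 3.  Then
-- e, the last letter of the cube, is the last letter of v, i.e. the letter of w at position (2n + 1)/3.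
-- Likewise a proper power w eⁿ forces w ∈ e*.  So if w aⁿ is primitive (hence w ∉ a*) but not
-- ins-robust, a is the letter of w at position (2n + 1)/3, and any failure of ins-robustness of w bⁿ
-- would make b that letter as well, or put w in b*.
module Submission where

open import Defs
open import Data.Nat using (ℕ; zero; suc; _+_; _*_; _≤_; _<_; _≥_; s≤s)
open import Data.Nat.Properties hiding (_≟_)
open import Data.Fin using (Fin; _≟_)
open import Data.List using (List; []; _∷_; _++_; length; replicate; take)
open import Data.List.Properties
  using (length-++; length-replicate; ++-assoc; ++-identityʳ; ++-conicalˡ; ∷-injectiveʳ; take++drop≡id)
open import Data.List.Relation.Unary.All using (All; []; _∷_)
open import Data.List.Relation.Unary.All.Properties using (++⁺; ++⁻; ++⁻ˡ; ++⁻ʳ; replicate⁺)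
open import Data.Maybe using (Maybe; just; nothing)
open import Data.Maybe.Properties using (just-injective)
open import Data.Product using (Σ; _×_; _,_; proj₁; proj₂)
open import Data.Sum using (_⊎_; inj₁; inj₂)
open import Data.Empty using (⊥; ⊥-elim)
open import Function using (_∘_)
open import Relation.Nullary using (¬_; yes; no)
open import Relation.Binary.PropositionalEquality

2*n≡n+n : ∀ n → 2 * n ≡ n + n
2*n≡n+n n = cong (n +_) (+-identityʳ n)

1+2n<2*[1+n] : ∀ n → suc (n + n) < 2 * suc n
1+2n<2*[1+n] n = ≤-reflexive (begin
  suc (suc (n + n)) ≡⟨ cong suc (+-suc n n) ⟨
  suc n + suc n     ≡⟨ 2*n≡n+n (suc n) ⟨
  2 * suc n         ∎)
  where open ≡-Reasoning

p*d≤1+2n⇒d≤n : ∀ {p d n} → 2 ≤ p → p * d ≤ suc (n + n) → d ≤ n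
p*d≤1+2n⇒d≤n {p} {d} {n} 2≤p p*d≤ = ≤-pred (*-cancelˡ-< 2 d (suc n) (begin-strict
  2 * d         ≤⟨ *-monoˡ-≤ d 2≤p ⟩
  p * d         ≤⟨ p*d≤ ⟩
  suc (n + n)   <⟨ 1+2n<2*[1+n] n ⟩
  2 * suc n     ∎))
  where open ≤-Reasoning

p*d≡1+2n⇒p≡3 : ∀ {p d n} → 2 ≤ p → p * d ≡ suc (n + n) → n < d + d → p ≡ 3
p*d≡1+2n⇒p≡3 {1} (s≤s ()) _ _
p*d≡1+2n⇒p≡3 {2} {d} {n} _ eq _ = ⊥-elim (even≢odd d n (trans eq (cong suc (sym (2*n≡n+n n)))))
p*d≡1+2n⇒p≡3 {3} _ _ _ = refl
p*d≡1+2n⇒p≡3 {p@(suc (suc (suc (suc r))))} {d} {n} _ eq n<2d = ⊥-elim (<-irrefl refl (begin-strict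
  2 * (d + d)   ≡⟨ cong (2 *_) (2*n≡n+n d) ⟨
  2 * (2 * d)   ≡⟨ *-assoc 2 2 d ⟨
  4 * d         ≤⟨ *-monoˡ-≤ d (m≤m+n 4 r) ⟩
  p * d         ≡⟨ eq ⟩
  suc (n + n)   <⟨ 1+2n<2*[1+n] n ⟩
  2 * suc n     ≤⟨ *-monoʳ-≤ 2 n<2d ⟩
  2 * (d + d)   ∎))
  where open ≤-Reasoning

module _ {A : Set} where

  at : ℕ → List A → Maybe A
  at _       []       = nothing
  at zero    (x ∷ _)  = just x
  at (suc m) (_ ∷ xs) = at m xs

  at-++ˡ : ∀ (xs ys : List A) {m} → m < length xs → at m (xs ++ ys) ≡ at m xs
  at-++ˡ (x ∷ xs) ys {zero}  _         = refl
  at-++ˡ (x ∷ xs) ys {suc m} (s≤s m<) = at-++ˡ xs ys m<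

  at-++ʳ : ∀ (xs ys : List A) m → at (length xs + m) (xs ++ ys) ≡ at m ys
  at-++ʳ []       ys m = refl
  at-++ʳ (x ∷ xs) ys m = at-++ʳ xs ys m

  at-replicate : ∀ n (x : A) {m} → m < n → at m (replicate n x) ≡ just x
  at-replicate (suc n) x {zero}  _        = refl
  at-replicate (suc n) x {suc m} (s≤s m<) = at-replicate n x m<

  All-at : ∀ {P : A → Set} {xs m y} → All P xs → at m xs ≡ just y → P y
  All-at {m = zero}  (px ∷ _)   refl = px
  All-at {m = suc m} (_  ∷ pxs) eq   = All-at pxs eq

  All≡⇒≡replicate : ∀ {x : A} {xs} → All (_≡ x) xs → xs ≡ replicate (length xs) x
  All≡⇒≡replicate []           = refl
  All≡⇒≡replicate (refl ∷ all) = cong (_ ∷_) (All≡⇒≡replicate all)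

  ++-≡⇒suffix : ∀ (xs ys us vs : List A) → xs ++ ys ≡ us ++ vs → length ys ≤ length vs →
    Σ (List A) λ ts → vs ≡ ts ++ ys
  ++-≡⇒suffix []       ys []       vs eq _ = [] , sym eq
  ++-≡⇒suffix []       ys (u ∷ us) vs eq |ys|≤ = ⊥-elim (<-irrefl refl (begin-strict
    length vs             ≤⟨ m≤n+m (length vs) (length us) ⟩
    length us + length vs ≡⟨ length-++ us ⟨
    length (us ++ vs)     <⟨ n<1+n _ ⟩
    length (u ∷ us ++ vs) ≡⟨ cong length eq ⟨
    length ys             ≤⟨ |ys|≤ ⟩
    length vs             ∎))
    where open ≤-Reasoning
  ++-≡⇒suffix (x ∷ xs) ys []       vs eq _ = x ∷ xs , sym eq
  ++-≡⇒suffix (x ∷ xs) ys (u ∷ us) vs eq |ys|≤ = ++-≡⇒suffix xs ys us vs (∷-injectiveʳ eq) |ys|≤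

module _ {k : ℕ} where

  length-^^ : ∀ (v : Word k) p → length (v ^^ p) ≡ p * length v
  length-^^ v zero    = refl
  length-^^ v (suc p) = trans (length-++ v) (cong (length v +_) (length-^^ v p))

  ^^-++-comm : ∀ (v : Word k) p → v ^^ p ++ v ≡ v ++ v ^^ p
  ^^-++-comm v zero    = sym (++-identityʳ v)
  ^^-++-comm v (suc p) = trans (++-assoc v (v ^^ p) v) (cong (v ++_) (^^-++-comm v p))

  All-^^ : ∀ {P : Fin k → Set} (v : Word k) p → All P v → All P (v ^^ p)
  All-^^ v zero    _     = []
  All-^^ v (suc p) all-v = ++⁺ all-v (All-^^ v p all-v)

  at-^^-period : ∀ (v : Word k) p m → m + length v < length (v ^^ p) →
    at (m + length v) (v ^^ p) ≡ at m (v ^^ p)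
  at-^^-period v (suc p) m bound = begin
    at (m + length v) (v ++ v ^^ p) ≡⟨ cong (λ i → at i (v ++ v ^^ p)) (+-comm m (length v)) ⟩
    at (length v + m) (v ++ v ^^ p) ≡⟨ at-++ʳ v (v ^^ p) m ⟩
    at m (v ^^ p)                   ≡⟨ at-++ˡ (v ^^ p) v m<|v^p| ⟨
    at m (v ^^ p ++ v)              ≡⟨ cong (at m) (^^-++-comm v p) ⟩
    at m (v ++ v ^^ p)              ∎
    where
    open ≡-Reasoning
    m<|v^p| : m < length (v ^^ p)
    m<|v^p| = +-cancelˡ-< (length v) m _ (subst₂ _<_ (+-comm m (length v)) (length-++ v) bound)

  ^^-length≤ : ∀ {x v : Word k} {p n} → 2 ≤ p → x ≡ v ^^ p → length x ≤ suc (n + n) → length v ≤ n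
  ^^-length≤ {x} {v} {p} 2≤p refl |x|≤ = p*d≤1+2n⇒d≤n 2≤p (subst (_≤ _) (length-^^ v p) |x|≤)

  -- v is a suffix of eᵐ, hence constant, hence so is the whole power.
  constant-tail⇒constant : ∀ (y v : Word k) p m e → y ++ replicate m e ≡ v ^^ p → length v ≤ m →
    All (_≡ e) y
  constant-tail⇒constant y v zero m e eq _ = subst (All (_≡ e)) (sym (++-conicalˡ y _ eq)) []
  constant-tail⇒constant y v (suc p) m e eq |v|≤m
    with ++-≡⇒suffix (v ^^ p) v y (replicate m e) (trans (^^-++-comm v p) (sym eq))
           (subst (length v ≤_) (sym (length-replicate m)) |v|≤m)
  ... | ts , eᵐ≡ts++v = ++⁻ˡ y (subst (All (_≡ e)) (sym eq) (All-^^ v (suc p) all-v))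
    where
    all-v : All (_≡ e) v
    all-v = ++⁻ʳ ts (subst (All (_≡ e)) eᵐ≡ts++v (replicate⁺ m refl))

  length-insertAt : ∀ i c (w : Word k) → length (insertAt i c w) ≡ suc (length w)
  length-insertAt zero    c w       = refl
  length-insertAt (suc i) c []      = refl
  length-insertAt (suc i) c (x ∷ w) = cong suc (length-insertAt i c w)

  insertAt-++ˡ : ∀ {i} c (w r : Word k) → i ≤ length w → insertAt i c (w ++ r) ≡ insertAt i c w ++ r
  insertAt-++ˡ {zero}  c w       r _        = refl
  insertAt-++ˡ {suc i} c (x ∷ w) r (s≤s i≤) = cong (x ∷_) (insertAt-++ˡ c w r i≤)

  insertAt-++ʳ : ∀ j c (w r : Word k) → insertAt (length w + j) c (w ++ r) ≡ w ++ insertAt j c r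
  insertAt-++ʳ j c []      r = refl
  insertAt-++ʳ j c (x ∷ w) r = cong (x ∷_) (insertAt-++ʳ j c w r)

  All-insertAt⁻ : ∀ {P : Fin k → Set} i c (w : Word k) → All P (insertAt i c w) → All P w
  All-insertAt⁻ i c w all with ++⁻ (take i w) all
  ... | all-take , _ ∷ all-drop = subst (All _) (take++drop≡id i w) (++⁺ all-take all-drop)

  at-insertAt : ∀ {i} c (w : Word k) → i ≤ length w → at i (insertAt i c w) ≡ just c
  at-insertAt {zero}  c w       _        = refl
  at-insertAt {suc i} c (x ∷ w) (s≤s i≤) = at-insertAt c w i≤

  at-insertAt-replicate : ∀ {n j m} c (e : Fin k) → j ≤ n → m ≤ n → m ≢ j →
    at m (insertAt j c (replicate n e)) ≡ just e
  at-insertAt-replicate {n}     {zero}  {zero}  c e _        _        m≢j = ⊥-elim (m≢j refl)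
  at-insertAt-replicate {n}     {zero}  {suc m} c e _        m<n      _   = at-replicate n e m<n
  at-insertAt-replicate {suc n} {suc j} {zero}  c e _        _        _   = refl
  at-insertAt-replicate {suc n} {suc j} {suc m} c e (s≤s j≤) (s≤s m≤) m≢j =
    at-insertAt-replicate c e j≤ m≤ (m≢j ∘ cong suc)

  insertAt-replicate : ∀ {n j} (e : Fin k) → j ≤ n → insertAt j e (replicate n e) ≡ replicate (suc n) e
  insertAt-replicate {n}     {zero}  e _        = refl
  insertAt-replicate {suc n} {suc j} e (s≤s j≤) = cong (e ∷_) (insertAt-replicate e j≤)

  ProperPower : Word k → Set
  ProperPower x = Σ (Word k) λ v → Σ ℕ λ p → (p ≥ 2) × (x ≡ v ^^ p)

  insRobust : ∀ {x : Word k} → Primitive x →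
    (∀ i → i ≤ length x → ∀ c → ¬ ProperPower (insertAt i c x)) → InsRobust x
  insRobust {x} prim no-power = prim , λ i i≤ c → nonempty i c , no-power i i≤ c
    where
    nonempty : ∀ i c → insertAt i c x ≢ []
    nonempty i c eq = 1+n≢0 (trans (sym (length-insertAt i c x)) (cong length eq))

  -- e is the letter of w at position (2|w| + 1)/3 (counting from 1): the last letter of a cube root
  -- of length (2|w| + 1)/3 whose cube begins with w.
  CubeRootEnd : Word k → Fin k → Set
  CubeRootEnd w e = Σ ℕ λ m → (3 * suc m ≡ suc (length w + length w)) × (at m w ≡ just e)

  CubeRootEnd-unique : ∀ (w : Word k) {a b} → CubeRootEnd w a → CubeRootEnd w b → a ≡ b
  CubeRootEnd-unique w (m , 3[1+m]≡ , wₘ≡a) (m′ , 3[1+m′]≡ , wₘ′≡b) =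
    just-injective (trans (sym wₘ≡a) (trans (cong (λ i → at i w) m≡m′) wₘ′≡b))
    where
    m≡m′ : m ≡ m′
    m≡m′ = suc-injective (*-cancelˡ-≡ (suc m) (suc m′) 3 (trans 3[1+m]≡ (sym 3[1+m′]≡)))

  All≡-CubeRootEnd : ∀ {w : Word k} {a b} → All (_≡ b) w → CubeRootEnd w a → a ≡ b
  All≡-CubeRootEnd all-b (_ , _ , wₘ≡a) = All-at all-b wₘ≡a

  module _ (w : Word k) (e : Fin k) where

    private
      n : ℕ
      n = length w

      eⁿ : Word k
      eⁿ = replicate n e

    length-w++eⁿ : length (w ++ eⁿ) ≡ n + n
    length-w++eⁿ = trans (length-++ w) (cong (n +_) (length-replicate n))

    ProperPower-w++eⁿ⇒constant : ProperPower (w ++ eⁿ) → All (_≡ e) w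
    ProperPower-w++eⁿ⇒constant (v , p , 2≤p , eq) =
      constant-tail⇒constant w v p n e eq (^^-length≤ 2≤p eq (m≤n⇒m≤1+n (≤-reflexive length-w++eⁿ)))

    module BlockInsertion {j c v p} (c≢e : c ≢ e) (j≤n : j ≤ n) (2≤p : 2 ≤ p)
                          (x≡vᵖ : w ++ insertAt j c eⁿ ≡ v ^^ p) where

      private
        s x : Word k
        s = insertAt j c eⁿ
        x = w ++ s

        d : ℕ
        d = length v

      length-x : length x ≡ suc (n + n)
      length-x = begin
        length (w ++ s)  ≡⟨ length-++ w ⟩
        n + length s     ≡⟨ cong (n +_) (trans (length-insertAt j c eⁿ) (cong suc (length-replicate n))) ⟩
        n + suc n        ≡⟨ +-suc n n ⟩
        suc (n + n)      ∎
        where open ≡-Reasoning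

      p*d≡ : p * d ≡ suc (n + n)
      p*d≡ = trans (sym (length-^^ v p)) (trans (cong length (sym x≡vᵖ)) length-x)

      d≤n : d ≤ n
      d≤n = p*d≤1+2n⇒d≤n 2≤p (≤-reflexive p*d≡)

      d>0 : 0 < d
      d>0 = n≢0⇒n>0 (λ d≡0 → 1+n≢0 (trans (sym p*d≡) (trans (cong (p *_) d≡0) (*-zeroʳ p))))

      period : ∀ {i} → i + d ≤ n + n → at (i + d) x ≡ at i x
      period {i} i+d≤ = subst (λ y → at (i + d) y ≡ at i y) (sym x≡vᵖ)
        (at-^^-period v p i (subst (i + d <_) (trans (sym length-x) (cong length x≡vᵖ)) (s≤s i+d≤)))

      block : ∀ {t} → t ≤ n → t ≢ j → at (n + t) x ≡ just e
      block t≤n t≢j = trans (at-++ʳ w s _) (at-insertAt-replicate c e j≤n t≤n t≢j)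

      apart : ∀ {t} → t ≤ n → t ≢ j → at (n + j) x ≢ at (n + t) x
      apart t≤n t≢j eq = c≢e (just-injective (trans (sym marked) (trans eq (block t≤n t≢j))))
        where
        marked : at (n + j) x ≡ just c
        marked = trans (at-++ʳ w s j) (at-insertAt c eⁿ (subst (j ≤_) (sym (length-replicate n)) j≤n))

      shift : ∀ {t u} → t + d ≡ u → u ≤ n → at (n + u) x ≡ at (n + t) x
      shift {t} {u} t+d≡u u≤n =
        trans (cong (λ i → at i x) (sym idx)) (period (subst (_≤ n + n) (sym idx) (+-monoʳ-≤ n u≤n)))
        where
        idx : n + t + d ≡ n + u
        idx = trans (+-assoc n t d) (cong (n +_) t+d≡u)

      -- c lies inside the block eⁿ, so the period reaches past both ends of the block.
      j<d : j < d
      j<d = ≰⇒> λ d≤j → apart (≤-trans (m∸n≤m j d) j≤n) (<⇒≢ (∸-monoʳ-< d>0 d≤j)) (shift (m∸n+n≡m d≤j) j≤n)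

      n<j+d : n < j + d
      n<j+d = ≰⇒> λ j+d≤n → apart j+d≤n (>⇒≢ (m<m+n j d>0)) (sym (shift refl j+d≤n))

      p≡3 : p ≡ 3
      p≡3 = p*d≡1+2n⇒p≡3 2≤p p*d≡ (<-≤-trans n<j+d (+-monoˡ-≤ d (<⇒≤ j<d)))

      cubeRootEnd : CubeRootEnd w e
      cubeRootEnd = m , 3[1+m]≡ , wₘ≡e
        where
        open ≡-Reasoning
        m : ℕ
        m = proj₁ (m≤n⇒∃[o]m+o≡n d>0)
        1+m≡d : suc m ≡ d
        1+m≡d = proj₂ (m≤n⇒∃[o]m+o≡n d>0)
        3[1+m]≡ : 3 * suc m ≡ suc (n + n)
        3[1+m]≡ = trans (cong (3 *_) 1+m≡d) (subst (λ q → q * d ≡ suc (n + n)) p≡3 p*d≡)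
        m+d+d≡n+n : m + d + d ≡ n + n
        m+d+d≡n+n = begin
          m + d + d                    ≡⟨ cong (λ i → m + i + i) 1+m≡d ⟨
          m + suc m + suc m            ≡⟨ +-assoc m (suc m) (suc m) ⟩
          m + (suc m + suc m)          ≡⟨ cong (λ i → m + (suc m + i)) (+-identityʳ (suc m)) ⟨
          m + (suc m + (suc m + 0))    ≡⟨ suc-injective 3[1+m]≡ ⟩
          n + n                        ∎
        wₘ≡e : at m w ≡ just e
        wₘ≡e = begin
          at m w            ≡⟨ at-++ˡ w s (<-≤-trans (subst (m <_) 1+m≡d ≤-refl) d≤n) ⟨
          at m x            ≡⟨ period (≤-trans (m≤m+n (m + d) d) (≤-reflexive m+d+d≡n+n)) ⟨
          at (m + d) x      ≡⟨ period (≤-reflexive m+d+d≡n+n) ⟨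
          at (m + d + d) x  ≡⟨ cong (λ i → at i x) m+d+d≡n+n ⟩
          at (n + n) x      ≡⟨ block ≤-refl (>⇒≢ (<-≤-trans j<d d≤n)) ⟩
          just e            ∎

    ProperPower-insertion : ∀ i → i ≤ length (w ++ eⁿ) → ∀ c → ProperPower (insertAt i c (w ++ eⁿ)) →
      All (_≡ e) w ⊎ CubeRootEnd w e
    ProperPower-insertion i i≤ c (v , p , 2≤p , eq) = classify (≤-total i n)
      where
      d≤n : length v ≤ n
      d≤n = ^^-length≤ 2≤p eq (≤-reflexive (trans (length-insertAt i c (w ++ eⁿ)) (cong suc length-w++eⁿ)))

      block-form : ∀ {j} → n + j ≡ i → w ++ insertAt j c eⁿ ≡ v ^^ p
      block-form {j} n+j≡i =
        trans (sym (insertAt-++ʳ j c w eⁿ)) (subst (λ i′ → insertAt i′ c (w ++ eⁿ) ≡ v ^^ p) (sym n+j≡i) eq)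

      j≤n : ∀ {j} → n + j ≡ i → j ≤ n
      j≤n {j} n+j≡i = +-cancelˡ-≤ n j n (subst (_≤ n + n) (sym n+j≡i) (subst (i ≤_) length-w++eⁿ i≤))

      eⁿ-insertion : ∀ {j} → c ≡ e → j ≤ n → insertAt j c eⁿ ≡ replicate (suc n) e
      eⁿ-insertion {j} c≡e j≤n = trans (cong (λ a → insertAt j a eⁿ) c≡e) (insertAt-replicate e j≤n)

      classify : i ≤ n ⊎ n ≤ i → All (_≡ e) w ⊎ CubeRootEnd w e
      classify (inj₁ i≤n) = inj₁ (All-insertAt⁻ i c w
        (constant-tail⇒constant (insertAt i c w) v p n e (trans (sym (insertAt-++ˡ c w eⁿ i≤n)) eq) d≤n))
      classify (inj₂ n≤i) with m≤n⇒∃[o]m+o≡n n≤i | c ≟ e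
      ... | j , n+j≡i | yes c≡e = inj₁ (constant-tail⇒constant w v p (suc n) e
        (trans (cong (w ++_) (sym (eⁿ-insertion c≡e (j≤n n+j≡i)))) (block-form n+j≡i)) (m≤n⇒m≤1+n d≤n))
      ... | j , n+j≡i | no c≢e  = inj₂ (BlockInsertion.cubeRootEnd c≢e (j≤n n+j≡i) 2≤p (block-form n+j≡i))

lemma16 : (k : ℕ) → k ≥ 2 → (w : Word k) → (n : ℕ) → length w ≡ n → (a : Fin k) →
    NonInsRobust (w ++ replicate n a) →
    (b : Fin k) → b ≢ a → InsRobust (w ++ replicate n b)
lemma16 k _ w .(length w) refl a (primitive-a , not-robust-a) b b≢a = insRobust primitive-b robust-b
  where
  n : ℕ
  n = length w

  not-constant-a : ¬ All (_≡ a) w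
  not-constant-a all-a = proj₂ primitive-a (replicate n a , 2 , ≤-refl ,
    cong₂ _++_ (All≡⇒≡replicate all-a) (sym (++-identityʳ (replicate n a))))

  clash : All (_≡ b) w ⊎ CubeRootEnd w b → All (_≡ a) w ⊎ CubeRootEnd w a → ⊥
  clash _              (inj₁ all-a) = not-constant-a all-a
  clash (inj₁ all-b)   (inj₂ end-a) = b≢a (sym (All≡-CubeRootEnd all-b end-a))
  clash (inj₂ end-b)   (inj₂ end-a) = b≢a (CubeRootEnd-unique w end-b end-a)

  not-pinned-b : ¬ (All (_≡ b) w ⊎ CubeRootEnd w b)
  not-pinned-b pinned-b = not-robust-a (insRobust primitive-a λ i i≤ c power →
    clash pinned-b (ProperPower-insertion w a i i≤ c power))

  primitive-b : Primitive (w ++ replicate n b)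
  primitive-b = (λ eq → proj₁ primitive-a (cong (λ u → u ++ replicate (length u) a) (++-conicalˡ w _ eq))) ,
                (λ power → not-pinned-b (inj₁ (ProperPower-w++eⁿ⇒constant w b power)))

  robust-b : ∀ i → i ≤ length (w ++ replicate n b) → ∀ c → ¬ ProperPower (insertAt i c (w ++ replicate n b))
  robust-b i i≤ c power = not-pinned-b (ProperPower-insertion w b i i≤ c power)
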